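{- In the setting described in the context, suppose $2\le n<\omega$, $\tau\in[B]^{n+1}$, and $\mathfrak{u}_n(\tau)$ holds. Then $\mathcal{S}_n(\tau) = (-1)^{n+1}\mathcal{C}_n(\tau)$ (as functions).
   Context: Let $\kappa$ be a regular uncountable cardinal and $\langle g_\alpha\mid\alpha<\kappa\rangle$ an injective sequence in ${}^\omega\omega$. Finite subsets of $\kappa$ are identified with increasing tuples; for a tuple $\vec\alpha$, $\vec\alpha^{\,i}$ is $\vec\alpha$ with its $i$-th entry (counting from 0) deleted, and $I(\vec\alpha)=\{(i,j)\in\omega^2: j\le\min_k g_{\alpha_k}(i)\}$. For each $n\ge1$, $\Phi_n=\langle\varphi_{\vec\alpha}:I(\vec\alpha)\to\mathbb{Z}\mid\vec\alpha\in[\kappa]^n\rangle$ is $n$-coherent, i.e. for every $\vec\beta\in[\kappa]^{n+1}$ the function $e(\vec\beta):=\sum_{i\le n}(-1)^i\varphi_{\vec\beta^{\,i}}$ (sum taken on $I(\vec\beta)$, the intersection of the domains) is finitely supported; $\mathtt{e}(\vec\beta)$ denotes the restriction of $e(\vec\beta)$ to its support. Let $B\subseteq\kappa$ be unbounded, and for each nonempty finite $\tau\subseteq B$ let $\alpha_\tau<\kappa$ be an ordinal with $\alpha_{\{\eta\}}=\eta$ and $\alpha_\rho<\alpha_\tau$ whenever $\rho\subsetneq\tau$. A subset-initial segment of $\tau$ is a sequence $\vec\sigma=\langle\sigma_1\subseteq\cdots\subseteq\sigma_m\rangle$ of subsets of $\tau$ with $m\le|\tau|$ and $|\sigma_i|=i$;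 it is a long string for $\tau$ if $m=|\tau|$; write $\vec\alpha[\vec\sigma]=\langle\alpha_{\sigma_1},\dots,\alpha_{\sigma_m}\rangle$. Formal expressions are finite integer linear combinations $L=\sum_i a_i e(\vec\alpha_i)$ of symbols $e(\vec\alpha)$ ($\vec\alpha$ increasing of length $\ge2$); the value of such an expression is the function $\sum_i a_i e(\vec\alpha_i)$ taken on the intersection of the domains. For $\vec\alpha$ of length $\ge3$ let $\mathsf{d}e(\vec\alpha)=\sum_{i<|\vec\alpha|}(-1)^ie(\vec\alpha^{\,i})$, extended linearly to $\mathsf{d}L$. For $\vec\beta$ above all entries of all $\vec\alpha_i$, $L*\vec\beta=\sum_ia_ie(\vec\alpha_i{}^\frown\vec\beta)$ (write $L*\beta$ for $L*\langle\beta\rangle$; $e(\tau,\alpha)$ means $e(\tau^\frown\langle\alpha\rangle)$). Define recursively: $\mathcal{A}_2(\rho)=e(\rho,\alpha_\rho)$ for $\rho\in[B]^2$; for $n\ge2$ and $\tau\in[B]^{n+1}$: $\mathcal{S}_n(\tau)=\mathsf{d}e(\tau,\alpha_\tau)-\sum_{i<n+1}(-1)^i\mathsf{d}[\mathcal{A}_n(\tau^i)*\alpha_\tau]$, $\mathcal{C}_n(\tau)=e(\tau)-\sum_{i<n+1}(-1)^i\mathcal{A}_n(\tau^i)$, and $\mathcal{A}_{n+1}(\tau)=(-1)^{n+1}\mathcal{C}_n(\tau)*\alpha_\tau$. The statement $\mathfrak{u}_n(\tau)$ is the conjunction of: (i) there is $\epsilon$ with $\mathtt{e}(\vec\alpha[\vec\sigma])=\epsilon$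 for every long string $\vec\sigma$ for $\tau$; (ii) for all nonempty $\rho\subsetneq\sigma\subseteq\tau$, $g_{\alpha_\rho}\le g_{\alpha_\sigma}$ pointwise. -}

module Defs where

open import Level using (0ℓ)
open import Data.Nat as ℕ using (ℕ; zero; suc)
open import Data.Integer as ℤ using (ℤ; 0ℤ; 1ℤ; -_; _*_; _+_)
open import Data.Fin using (Fin; toℕ)
open import Data.List using (List; []; _∷_; _++_; [_]; length; map; concat; foldr; lookup; allFin)
open import Data.List.Membership.Propositional using (_∈_)
open import Data.List.Relation.Unary.All using (All)
open import Data.List.Relation.Unary.Linked using (Linked)
open import Data.Maybe using (Maybe; just; nothing)
open import Data.Product using (Σ; ∃; _×_; _,_; proj₁; proj₂)
open import Relation.Binary.PropositionalEquality using (_≡_; _≢_)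
open import Relation.Binary.Structures using (IsStrictTotalOrder)
open import Induction.WellFounded using (WellFounded)
open import Function.Bundles using (_↣_)
open import Relation.Nullary using (¬_)

sgn : ℕ → ℤ
sgn zero    = 1ℤ
sgn (suc i) = - sgn i

Σℤ : List ℤ → ℤ
Σℤ = foldr _+_ 0ℤ

face : {A : Set} (xs : List A) → Fin (length xs) → List A
face = Data.List.removeAt

-- The setting: κ regular uncountable cardinal, represented by the type
-- of ordinals below κ with their (well-)order.

record Setting : Set₁ where
  field
    K   : Set
    _<_ : K → K → Set
    <-sto : IsStrictTotalOrder _≡_ _<_
    <-wf  : WellFounded _<_
    cardinal : ∀ (a : K) → ¬ (K ↣ Σ K (λ b → b < a))
    uncountable : ¬ (K ↣ ℕ)
    regular : ∀ (X : Set) (f : X → K) → (∀ b → ∃ λ x → ¬ (f x < b)) → K ↣ X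
    g     : K → ℕ → ℕ
    g-inj : ∀ a b → (∀ i → g a i ≡ g b i) → a ≡ b
    -- φ_α for increasing tuples α of length ≥ 1 (only values on I(α) matter)
    φ : List K → ℕ → ℕ → ℤ

  -- increasing tuples = finite subsets of κ
  Increasing : List K → Set
  Increasing = Linked _<_

  I : List K → ℕ → ℕ → Set
  I α i j = All (λ a → j ℕ.≤ g a i) α

  e : List K → ℕ → ℕ → ℤ
  e β i j = Σℤ (map (λ k → sgn (toℕ k) * φ (face β k) i j) (allFin (length β)))

  FinSupp : List K → Set
  FinSupp β = ∃ λ (P : List (ℕ × ℕ)) → ∀ i j → I β i j → e β i j ≢ 0ℤ → (i , j) ∈ P

  field
    coherent : ∀ β → Increasing β → 2 ℕ.≤ length β → FinSupp β
    B : K → Set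
    B-unbounded : ∀ a → ∃ λ b → B b × a < b

  FinSubB : List K → Set
  FinSubB τ = Increasing τ × All B τ × τ ≢ []

  _⊆ₛ_ : List K → List K → Set
  ρ ⊆ₛ τ = ∀ x → x ∈ ρ → x ∈ τ

  _⊊ₛ_ : List K → List K → Set
  ρ ⊊ₛ τ = ρ ⊆ₛ τ × ρ ≢ τ

  field
    αs : List K → K
    αs-single : ∀ η → B η → αs [ η ] ≡ η
    αs-mono   : ∀ ρ τ → FinSubB ρ → FinSubB τ → ρ ⊊ₛ τ → αs ρ < αs τ

  SubsetInitial : List K → List (List K) → Set
  SubsetInitial τ σs =
    length σs ℕ.≤ length τ ×
    (∀ (k : Fin (length σs)) →
        Increasing (lookup σs k) × length (lookup σs k) ≡ suc (toℕ k) × lookup σs k ⊆ₛ τ) ×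
    Linked _⊆ₛ_ σs

  LongString : List K → List (List K) → Set
  LongString τ σs = SubsetInitial τ σs × length σs ≡ length τ

  αvec : List (List K) → List K
  αvec σs = map αs σs

  -- 𝚎(β) = restriction of e(β) to its support; "RestrIs β ε" says 𝚎(β) = ε
  -- where ε is a partial function ω² ⇀ ℤ.

  Supp : List K → ℕ → ℕ → Set
  Supp β i j = I β i j × e β i j ≢ 0ℤ

  RestrIs : List K → (ℕ → ℕ → Maybe ℤ) → Set
  RestrIs β ε = ∀ i j → (Supp β i j → ε i j ≡ just (e β i j)) × (¬ Supp β i j → ε i j ≡ nothing)

  U : List K → Set
  U τ =
    (∃ λ (ε : ℕ → ℕ → Maybe ℤ) → ∀ σs → LongString τ σs → RestrIs (αvec σs) ε) ×
    (∀ ρ σ → Increasing ρ → Increasing σ → ρ ≢ [] → ρ ⊊ₛ σ → σ ⊆ₛ τ →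
       ∀ i → g (αs ρ) i ℕ.≤ g (αs σ) i)

  -- formal expressions  Σ a_i e(α⃗_i)  as lists of (coefficient, tuple)

  FExpr : Set
  FExpr = List (ℤ × List K)

  scale : ℤ → FExpr → FExpr
  scale c = map (λ t → c * proj₁ t , proj₂ t)

  altFaces : (τ : List K) → (List K → FExpr) → FExpr
  altFaces τ F = concat (map (λ k → scale (sgn (toℕ k)) (F (face τ k))) (allFin (length τ)))

  d : FExpr → FExpr
  d = concat ∘' map (λ t → scale (proj₁ t) (altFaces (proj₂ t) (λ β → (1ℤ , β) ∷ [])))
    where
      _∘'_ : {A B C : Set} → (B → C) → (A → B) → A → C
      (f ∘' h) x = f (h x)

  _✱_ : FExpr → List K → FExpr
  L ✱ β = map (λ t → proj₁ t , proj₂ t ++ β) L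

  Dom : FExpr → ℕ → ℕ → Set
  Dom L i j = All (λ t → I (proj₂ t) i j) L

  val : FExpr → ℕ → ℕ → ℤ
  val L i j = Σℤ (map (λ t → proj₁ t * e (proj₂ t) i j) L)

  SameFn : FExpr → FExpr → Set
  SameFn L M = ∀ i j → (Dom L i j → Dom M i j) × (Dom M i j → Dom L i j) ×
                       (Dom L i j → val L i j ≡ val M i j)

  mutual
    𝒜 : ℕ → List K → FExpr
    𝒜 zero ρ = []
    𝒜 (suc zero) ρ = []
    𝒜 (suc (suc zero)) ρ = (1ℤ , ρ ++ [ αs ρ ]) ∷ []
    𝒜 (suc (suc (suc m))) τ = scale (sgn (suc (suc (suc m)))) (𝒞 (suc (suc m)) τ ✱ [ αs τ ])

    𝒞 : ℕ → List K → FExpr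
    𝒞 n τ = (1ℤ , τ) ∷ scale (- 1ℤ) (altFaces τ (𝒜 n))

  𝒮 : ℕ → List K → FExpr
  𝒮 n τ = d ((1ℤ , τ ++ [ αs τ ]) ∷ [])
          ++ scale (- 1ℤ) (altFaces τ (λ ρ → d (𝒜 n ρ ✱ [ αs τ ])))

module Submission where

-- Both sides vanish wherever they are defined, and both are defined exactly on I(τ).
--
-- Since e = ∂φ and ∂∂ = 0, every formal coboundary d L evaluates to 0; 𝒮_n(τ) is a sum of such.
-- For 𝒞_n(τ), the cocycle identity at γ⌢α_τ expresses e(γ) as ±∂(e(·⌢α_τ))(γ), a coboundary
-- with the last entry frozen. Freezing the α-values of a partial long string as a tail β, the
-- recursion 𝒜_{k+1}(σ) = ±𝒞_k(σ) * α_σ lets the face terms of 𝒞_{k+1} be computed from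
-- 𝒞_k one level up the string (induction), and ∂∂ = 0 cancels them against the leading term.
-- At the bottom one is left with e(x₁⌢β) − e(x₀⌢β), values of e on two long strings, equal by 𝔲_n(τ).
-- For the domains: every entry of every tuple on either side is an entry of τ or some α_σ with
-- σ ⊆ τ, and monotonicity of g along ⊆ puts (i , j) ∈ I(τ) below all of them.

open import Defs
open import Data.Empty using (⊥-elim)
open import Data.Fin using (Fin; toℕ; zero; suc)
open import Data.Integer as ℤ using (ℤ; 0ℤ; 1ℤ; -_; _*_; _+_; _-_)
import Data.Integer.Properties as ℤP
open import Algebra.Properties.Semiring.Sum ℤP.+-*-semiring using (sum; sum-cong-≗; sum-replicate-zero; ∑-distrib-+; *-distribˡ-sum)
open import Data.Integer.Tactic.RingSolver using (solve-∀)
open import Data.List using (List; []; _∷_; _++_; [_]; _∷ʳ_; length; removeAt; map; concat; tabulate; allFin; lookup)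
open import Data.List.Membership.Propositional using (_∈_)
open import Data.List.Properties using (map-tabulate; map-cong; map-∘; length-++; ++-assoc; length-removeAt′)
open import Data.List.Relation.Unary.All as All using (All; []; _∷_)
import Data.List.Relation.Unary.All.Properties as AllP
open import Data.List.Relation.Unary.AllPairs using (AllPairs; _∷_)
open import Data.List.Relation.Unary.Any using (here; there; index)
open import Data.List.Relation.Unary.Any.Properties using (lookup-index)
open import Data.List.Relation.Unary.Linked using (Linked; [-]; _∷_)
open import Data.List.Relation.Unary.Linked.Properties using (AllPairs⇒Linked; Linked⇒AllPairs)
open import Data.Maybe using (fromMaybe)
open import Data.Nat as ℕ using (ℕ; zero; suc; _≤_)
import Data.Nat.Properties as ℕP
open import Data.Product using (_×_; _,_; proj₁; proj₂)
open import Function using (_∘_; id)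
open import Relation.Binary.Core using (Rel)
open import Relation.Binary.Definitions using (Transitive)
open import Relation.Binary.PropositionalEquality using (_≡_; _≢_; refl; sym; trans; cong; cong₂; subst; module ≡-Reasoning)
open import Relation.Binary.Structures using (IsStrictTotalOrder)
open import Relation.Nullary using (yes; no)

module _ {A : Set} where

  length-∷ʳ : ∀ (xs : List A) x → length (xs ∷ʳ x) ≡ suc (length xs)
  length-∷ʳ xs x = trans (length-++ xs) (ℕP.+-comm (length xs) 1)

  All-removeAt : ∀ {p} {P : A → Set p} {xs} → All P xs → (k : Fin (length xs)) → All P (removeAt xs k)
  All-removeAt (_ ∷ ps) zero    = ps
  All-removeAt (p ∷ ps) (suc k) = p ∷ All-removeAt ps k

  AllPairs-removeAt : ∀ {ℓ} {R : Rel A ℓ} {xs} → AllPairs R xs → (k : Fin (length xs)) → AllPairs R (removeAt xs k)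
  AllPairs-removeAt (_ ∷ ps) zero    = ps
  AllPairs-removeAt (p ∷ ps) (suc k) = All-removeAt p k ∷ AllPairs-removeAt ps k

  Linked-removeAt : ∀ {ℓ} {R : Rel A ℓ} → Transitive R →
                    ∀ {xs} → Linked R xs → (k : Fin (length xs)) → Linked R (removeAt xs k)
  Linked-removeAt trans l k = AllPairs⇒Linked (AllPairs-removeAt (Linked⇒AllPairs trans l) k)

  ∈-removeAt⁻ : ∀ {x : A} xs (k : Fin (length xs)) → x ∈ removeAt xs k → x ∈ xs
  ∈-removeAt⁻ (_ ∷ _)  zero    x∈       = there x∈
  ∈-removeAt⁻ (_ ∷ _)  (suc k) (here p) = here p
  ∈-removeAt⁻ (_ ∷ xs) (suc k) (there x∈) = there (∈-removeAt⁻ xs k x∈)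

  length-removeAt-suc : ∀ (xs : List A) {m} (k : Fin (length xs)) → length xs ≡ suc m → length (removeAt xs k) ≡ m
  length-removeAt-suc xs k eq = ℕP.suc-injective (trans (sym (length-removeAt′ xs k)) eq)

  Linked-∷ʳ : ∀ {ℓ} {R : Rel A ℓ} xs {x y} → Linked R (xs ∷ʳ x) → R x y → Linked R (xs ∷ʳ x ∷ʳ y)
  Linked-∷ʳ []           _         r = r ∷ [-]
  Linked-∷ʳ (_ ∷ [])     (r′ ∷ l)  r = r′ ∷ Linked-∷ʳ [] l r
  Linked-∷ʳ (_ ∷ z ∷ xs) (r′ ∷ l)  r = r′ ∷ Linked-∷ʳ (z ∷ xs) l r

  lookup-∷ʳ : ∀ (P : ℕ → A → Set) xs {y} → (∀ k → P (toℕ k) (lookup xs k)) → P (length xs) y →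
              ∀ k → P (toℕ k) (lookup (xs ∷ʳ y) k)
  lookup-∷ʳ P []       p q zero    = q
  lookup-∷ʳ P (x ∷ xs) p q zero    = p zero
  lookup-∷ʳ P (x ∷ xs) p q (suc k) = lookup-∷ʳ (P ∘ suc) xs (p ∘ suc) q k

Σℤ-tabulate : ∀ {n} (f : Fin n → ℤ) → Σℤ (tabulate f) ≡ sum f
Σℤ-tabulate {zero}  f = refl
Σℤ-tabulate {suc n} f = cong (f zero +_) (Σℤ-tabulate (f ∘ suc))

Σℤ-allFin : ∀ {n} (f : Fin n → ℤ) → Σℤ (map f (allFin n)) ≡ sum f
Σℤ-allFin f = trans (cong Σℤ (map-tabulate id f)) (Σℤ-tabulate f)

sgn² : ∀ n → sgn n * sgn n ≡ 1ℤ
sgn² zero    = refl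
sgn² (suc n) = trans (neg*neg (sgn n)) (sgn² n)
  where
  neg*neg : ∀ s → - s * - s ≡ s * s
  neg*neg = solve-∀

sum-neg : ∀ {n} (f : Fin n → ℤ) → sum (λ k → - f k) ≡ - sum f
sum-neg f = begin
  sum (λ k → - f k)        ≡⟨ sum-cong-≗ (λ k → sym (ℤP.-1*i≡-i (f k))) ⟩
  sum (λ k → - 1ℤ * f k)   ≡⟨ *-distribˡ-sum (- 1ℤ) f ⟨
  - 1ℤ * sum f             ≡⟨ ℤP.-1*i≡-i (sum f) ⟩
  - sum f                  ∎
  where open ≡-Reasoning

isolate : ∀ s a x → s * s ≡ 1ℤ → a + s * x ≡ 0ℤ → x ≡ - s * a
isolate s a x s²≡1 a+sx≡0 = begin
  x                                            ≡⟨ expand s a x ⟩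
  - s * a + s * (a + s * x) + (1ℤ - s * s) * x ≡⟨ cong₂ (λ u v → - s * a + s * u + (1ℤ - v) * x) a+sx≡0 s²≡1 ⟩
  - s * a + s * 0ℤ + (1ℤ - 1ℤ) * x             ≡⟨ collapse s a x ⟩
  - s * a                                      ∎
  where
  open ≡-Reasoning
  expand : ∀ s a x → x ≡ - s * a + s * (a + s * x) + (1ℤ - s * s) * x
  expand = solve-∀
  collapse : ∀ s a x → - s * a + s * 0ℤ + (1ℤ - 1ℤ) * x ≡ - s * a
  collapse = solve-∀

∂ : {A : Set} → (List A → ℤ) → List A → ℤ
∂ h γ = sum (λ k → sgn (toℕ k) * h (removeAt γ k))

module _ {A : Set} where

  ∂-cong-faces : ∀ {f g : List A → ℤ} γ → (∀ k → f (removeAt γ k) ≡ g (removeAt γ k)) → ∂ f γ ≡ ∂ g γ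
  ∂-cong-faces γ eq = sum-cong-≗ (λ k → cong (sgn (toℕ k) *_) (eq k))

  ∂-cong : ∀ {f g : List A → ℤ} → (∀ ρ → f ρ ≡ g ρ) → ∀ γ → ∂ f γ ≡ ∂ g γ
  ∂-cong {f} {g} eq γ = ∂-cong-faces {f = f} {g = g} γ (λ k → eq (removeAt γ k))

  ∂-distrib-minus : ∀ (f g : List A → ℤ) γ → ∂ (λ ρ → f ρ - g ρ) γ ≡ ∂ f γ - ∂ g γ
  ∂-distrib-minus f g γ = begin
    ∂ (λ ρ → f ρ - g ρ) γ          ≡⟨ sum-cong-≗ (λ k → distrib (sgn (toℕ k)) (f (removeAt γ k)) (g (removeAt γ k))) ⟩
    sum (λ k → f′ k + - g′ k)       ≡⟨ ∑-distrib-+ f′ (λ k → - g′ k) ⟩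
    ∂ f γ + sum (λ k → - g′ k)      ≡⟨ cong (∂ f γ +_) (sum-neg g′) ⟩
    ∂ f γ - ∂ g γ                   ∎
    where
    open ≡-Reasoning
    f′ g′ : Fin (length γ) → ℤ
    f′ k = sgn (toℕ k) * f (removeAt γ k)
    g′ k = sgn (toℕ k) * g (removeAt γ k)
    distrib : ∀ s a b → s * (a - b) ≡ s * a + - (s * b)
    distrib = solve-∀

  ∂-zero : ∀ (γ : List A) → ∂ (λ _ → 0ℤ) γ ≡ 0ℤ
  ∂-zero γ = trans (sum-cong-≗ {length γ} (λ k → ℤP.*-zeroʳ (sgn (toℕ k)))) (sum-replicate-zero (length γ))

  ∂-∷ : ∀ (h : List A → ℤ) x γ → ∂ h (x ∷ γ) ≡ h γ - ∂ (λ ρ → h (x ∷ ρ)) γ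
  ∂-∷ h x γ = begin
    1ℤ * h γ + sum (λ k → - sgn (toℕ k) * hₓ (removeAt γ k))
      ≡⟨ cong₂ _+_ (ℤP.*-identityˡ (h γ)) (sum-cong-≗ (λ k → sym (ℤP.neg-distribˡ-* (sgn (toℕ k)) (hₓ (removeAt γ k))))) ⟩
    h γ + sum (λ k → - (sgn (toℕ k) * hₓ (removeAt γ k)))
      ≡⟨ cong (h γ +_) (sum-neg (λ k → sgn (toℕ k) * hₓ (removeAt γ k))) ⟩
    h γ - ∂ hₓ γ
      ∎
    where
    open ≡-Reasoning
    hₓ : List A → ℤ
    hₓ ρ = h (x ∷ ρ)

  ∂∂≡0 : ∀ (h : List A → ℤ) γ → ∂ (∂ h) γ ≡ 0ℤ
  ∂∂≡0 h []      = refl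
  ∂∂≡0 h (x ∷ γ) = begin
    ∂ (∂ h) (x ∷ γ)                   ≡⟨ ∂-∷ (∂ h) x γ ⟩
    ∂ h γ - ∂ (λ ρ → ∂ h (x ∷ ρ)) γ  ≡⟨ cong (λ z → ∂ h γ - z) (∂-cong (∂-∷ h x) γ) ⟩
    ∂ h γ - ∂ (λ ρ → h ρ - ∂ hₓ ρ) γ ≡⟨ cong (λ z → ∂ h γ - z) (∂-distrib-minus h (∂ hₓ) γ) ⟩
    ∂ h γ - (∂ h γ - ∂ (∂ hₓ) γ)     ≡⟨ cong (λ z → ∂ h γ - (∂ h γ - z)) (∂∂≡0 hₓ γ) ⟩
    ∂ h γ - (∂ h γ - 0ℤ)              ≡⟨ cancel (∂ h γ) ⟩
    0ℤ                                ∎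
    where
    open ≡-Reasoning
    hₓ : List A → ℤ
    hₓ ρ = h (x ∷ ρ)
    cancel : ∀ a → a - (a - 0ℤ) ≡ 0ℤ
    cancel = solve-∀

  ∂-∷ʳ : ∀ (h : List A → ℤ) γ a → ∂ h (γ ∷ʳ a) ≡ ∂ (λ ρ → h (ρ ∷ʳ a)) γ + sgn (length γ) * h γ
  ∂-∷ʳ h []      a = swap (h [])
    where
    swap : ∀ z → 1ℤ * z + 0ℤ ≡ 0ℤ + 1ℤ * z
    swap = solve-∀
  ∂-∷ʳ h (x ∷ γ) a = begin
    ∂ h (x ∷ γ ∷ʳ a)
      ≡⟨ ∂-∷ h x (γ ∷ʳ a) ⟩
    h (γ ∷ʳ a) - ∂ (λ ρ → h (x ∷ ρ)) (γ ∷ʳ a)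
      ≡⟨ cong (λ z → h (γ ∷ʳ a) - z) (∂-∷ʳ (λ ρ → h (x ∷ ρ)) γ a) ⟩
    h (γ ∷ʳ a) - (∂ (λ ρ → h (x ∷ ρ ∷ʳ a)) γ + sgn (length γ) * h (x ∷ γ))
      ≡⟨ regroup (h (γ ∷ʳ a)) _ (sgn (length γ)) (h (x ∷ γ)) ⟩
    (h (γ ∷ʳ a) - ∂ (λ ρ → h (x ∷ ρ ∷ʳ a)) γ) + - sgn (length γ) * h (x ∷ γ)
      ≡⟨ cong (_+ - sgn (length γ) * h (x ∷ γ)) (∂-∷ (λ ρ → h (ρ ∷ʳ a)) x γ) ⟨
    ∂ (λ ρ → h (ρ ∷ʳ a)) (x ∷ γ) + sgn (length (x ∷ γ)) * h (x ∷ γ) ∎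
    where
    open ≡-Reasoning
    regroup : ∀ p q s r → p - (q + s * r) ≡ (p - q) + - s * r
    regroup = solve-∀

module _ (S : Setting) where
  open Setting S

  eval : (List K → ℤ) → FExpr → ℤ
  eval h L = Σℤ (map (λ t → proj₁ t * h (proj₂ t)) L)

  eval-++ : ∀ h L M → eval h (L ++ M) ≡ eval h L + eval h M
  eval-++ h []            M = sym (ℤP.+-identityˡ (eval h M))
  eval-++ h ((a , γ) ∷ L) M =
    trans (cong (a * h γ +_) (eval-++ h L M)) (sym (ℤP.+-assoc (a * h γ) (eval h L) (eval h M)))

  eval-scale : ∀ h c L → eval h (scale c L) ≡ c * eval h L
  eval-scale h c []            = sym (ℤP.*-zeroʳ c)
  eval-scale h c ((a , γ) ∷ L) =
    trans (cong₂ _+_ (ℤP.*-assoc c a (h γ)) (eval-scale h c L)) (sym (ℤP.*-distribˡ-+ c (a * h γ) (eval h L)))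

  eval-* : ∀ c h L → eval (λ γ → c * h γ) L ≡ c * eval h L
  eval-* c h []            = sym (ℤP.*-zeroʳ c)
  eval-* c h ((a , γ) ∷ L) =
    trans (cong₂ _+_ (swap a c (h γ)) (eval-* c h L)) (sym (ℤP.*-distribˡ-+ c (a * h γ) (eval h L)))
    where
    swap : ∀ a c x → a * (c * x) ≡ c * (a * x)
    swap = solve-∀

  eval-+ : ∀ f g L → eval (λ γ → f γ + g γ) L ≡ eval f L + eval g L
  eval-+ f g []            = refl
  eval-+ f g ((a , γ) ∷ L) =
    trans (cong (a * (f γ + g γ) +_) (eval-+ f g L)) (regroup a (f γ) (g γ) (eval f L) (eval g L))
    where
    regroup : ∀ a x y p q → a * (x + y) + (p + q) ≡ (a * x + p) + (a * y + q)
    regroup = solve-∀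

  eval-cong : ∀ {f g} {L : FExpr} → All (λ t → f (proj₂ t) ≡ g (proj₂ t)) L → eval f L ≡ eval g L
  eval-cong {L = []}          []       = refl
  eval-cong {L = (a , γ) ∷ L} (p ∷ ps) = cong₂ (λ x y → a * x + y) p (eval-cong ps)

  eval-zero : ∀ {h} → (∀ γ → h γ ≡ 0ℤ) → ∀ L → eval h L ≡ 0ℤ
  eval-zero h≡0 []            = refl
  eval-zero h≡0 ((a , γ) ∷ L) = cong₂ _+_ (trans (cong (a *_) (h≡0 γ)) (ℤP.*-zeroʳ a)) (eval-zero h≡0 L)

  eval-concat-map : ∀ {B : Set} h (F : B → FExpr) xs →
                    eval h (concat (map F xs)) ≡ Σℤ (map (λ x → eval h (F x)) xs)
  eval-concat-map h F []       = refl
  eval-concat-map h F (x ∷ xs) = trans (eval-++ h (F x) _) (cong (eval h (F x) +_) (eval-concat-map h F xs))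

  eval-altFaces : ∀ h γ F → eval h (altFaces γ F) ≡ ∂ (λ ρ → eval h (F ρ)) γ
  eval-altFaces h γ F = begin
    eval h (altFaces γ F)
      ≡⟨ eval-concat-map h (λ k → scale (sgn (toℕ k)) (F (removeAt γ k))) (allFin (length γ)) ⟩
    Σℤ (map (λ k → eval h (scale (sgn (toℕ k)) (F (removeAt γ k)))) (allFin (length γ)))
      ≡⟨ cong Σℤ (map-cong (λ k → eval-scale h (sgn (toℕ k)) (F (removeAt γ k))) (allFin (length γ))) ⟩
    Σℤ (map (λ k → sgn (toℕ k) * eval h (F (removeAt γ k))) (allFin (length γ)))
      ≡⟨ Σℤ-allFin (λ k → sgn (toℕ k) * eval h (F (removeAt γ k))) ⟩
    ∂ (λ ρ → eval h (F ρ)) γ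
      ∎
    where open ≡-Reasoning

  eval-✱ : ∀ h L β → eval h (L ✱ β) ≡ eval (λ γ → h (γ ++ β)) L
  eval-✱ h L β = cong Σℤ (sym (map-∘ L))

  eval-d : ∀ h L → eval h (d L) ≡ eval (∂ h) L
  eval-d h L = trans (eval-concat-map h (λ t → scale (proj₁ t) (altFaces (proj₂ t) single)) L)
                     (cong Σℤ (map-cong term L))
    where
    single : List K → FExpr
    single β = (1ℤ , β) ∷ []
    unit : ∀ x → 1ℤ * x + 0ℤ ≡ x
    unit = solve-∀
    term : ∀ t → eval h (scale (proj₁ t) (altFaces (proj₂ t) single)) ≡ proj₁ t * ∂ h (proj₂ t)
    term (a , γ) = trans (eval-scale h a (altFaces γ single))
                         (cong (a *_) (trans (eval-altFaces h γ single) (∂-cong (λ ρ → unit (h ρ)) γ)))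

  eval-𝒞 : ∀ h m ρ → eval h (𝒞 m ρ) ≡ h ρ - ∂ (λ σ → eval h (𝒜 m σ)) ρ
  eval-𝒞 h m ρ = cong₂ _+_ (ℤP.*-identityˡ (h ρ)) (begin
    eval h (scale (- 1ℤ) (altFaces ρ (𝒜 m)))  ≡⟨ eval-scale h (- 1ℤ) (altFaces ρ (𝒜 m)) ⟩
    - 1ℤ * eval h (altFaces ρ (𝒜 m))           ≡⟨ ℤP.-1*i≡-i _ ⟩
    - eval h (altFaces ρ (𝒜 m))                ≡⟨ cong -_ (eval-altFaces h ρ (𝒜 m)) ⟩
    - ∂ (λ σ → eval h (𝒜 m σ)) ρ               ∎)
    where open ≡-Reasoning

  eval-𝒜 : ∀ h m ρ → eval h (𝒜 (suc (suc m)) ρ) ≡ sgn (suc (suc m)) * eval (λ γ → h (γ ∷ʳ αs ρ)) (𝒞 (suc m) ρ)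
  eval-𝒜 h zero    ρ = begin
    1ℤ * h (ρ ∷ʳ αs ρ) + 0ℤ                ≡⟨ simplify (h (ρ ∷ʳ αs ρ)) ⟩
    1ℤ * (h (ρ ∷ʳ αs ρ) - 0ℤ)              ≡⟨ cong (λ z → 1ℤ * (h (ρ ∷ʳ αs ρ) - z)) (∂-zero ρ) ⟨
    1ℤ * (h (ρ ∷ʳ αs ρ) - ∂ (λ _ → 0ℤ) ρ)  ≡⟨ cong (1ℤ *_) (eval-𝒞 (λ γ → h (γ ∷ʳ αs ρ)) 1 ρ) ⟨
    1ℤ * eval (λ γ → h (γ ∷ʳ αs ρ)) (𝒞 1 ρ) ∎
    where
    open ≡-Reasoning
    simplify : ∀ x → 1ℤ * x + 0ℤ ≡ 1ℤ * (x - 0ℤ)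
    simplify = solve-∀
  eval-𝒜 h (suc m) ρ = trans (eval-scale h s (C ✱ [ αs ρ ])) (cong (s *_) (eval-✱ h C [ αs ρ ]))
    where
    s = sgn (suc (suc (suc m)))
    C = 𝒞 (suc (suc m)) ρ

  ∂-eval-𝒞 : ∀ h m ρ → ∂ (λ σ → eval h (𝒞 m σ)) ρ ≡ ∂ h ρ
  ∂-eval-𝒞 h m ρ = begin
    ∂ (λ σ → eval h (𝒞 m σ)) ρ  ≡⟨ ∂-cong (eval-𝒞 h m) ρ ⟩
    ∂ (λ σ → h σ - ∂ a σ) ρ     ≡⟨ ∂-distrib-minus h (∂ a) ρ ⟩
    ∂ h ρ - ∂ (∂ a) ρ           ≡⟨ cong (λ z → ∂ h ρ - z) (∂∂≡0 a ρ) ⟩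
    ∂ h ρ - 0ℤ                  ≡⟨ ℤP.+-identityʳ (∂ h ρ) ⟩
    ∂ h ρ                       ∎
    where
    open ≡-Reasoning
    a : List K → ℤ
    a σ = eval h (𝒜 m σ)

  eval-𝒮≡0 : ∀ {h} → (∀ γ → ∂ h γ ≡ 0ℤ) → ∀ n τ → eval h (𝒮 n τ) ≡ 0ℤ
  eval-𝒮≡0 {h} ∂h≡0 n τ = begin
    eval h (𝒮 n τ)
      ≡⟨ eval-++ h (d top) (scale (- 1ℤ) (altFaces τ F)) ⟩
    eval h (d top) + eval h (scale (- 1ℤ) (altFaces τ F))
      ≡⟨ cong₂ _+_ (d-vanishes top) (eval-scale h (- 1ℤ) (altFaces τ F)) ⟩
    0ℤ + - 1ℤ * eval h (altFaces τ F)
      ≡⟨ cong (λ z → 0ℤ + - 1ℤ * z) (eval-altFaces h τ F) ⟩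
    0ℤ + - 1ℤ * ∂ (λ ρ → eval h (F ρ)) τ
      ≡⟨ cong (λ z → 0ℤ + - 1ℤ * z) (trans (∂-cong (λ ρ → d-vanishes (𝒜 n ρ ✱ [ αs τ ])) τ) (∂-zero τ)) ⟩
    0ℤ
      ∎
    where
    open ≡-Reasoning
    top : FExpr
    top = (1ℤ , τ ∷ʳ αs τ) ∷ []
    F : List K → FExpr
    F ρ = d (𝒜 n ρ ✱ [ αs τ ])
    d-vanishes : ∀ L → eval h (d L) ≡ 0ℤ
    d-vanishes L = trans (eval-d h L) (eval-zero ∂h≡0 L)

  AllTuples : (List K → Set) → FExpr → Set
  AllTuples Q = All (Q ∘ proj₂)

  module _ {Q : List K → Set} where

    AllTuples-scale : ∀ c {L} → AllTuples Q L → AllTuples Q (scale c L)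
    AllTuples-scale c = AllP.map⁺ {f = λ t → c * proj₁ t , proj₂ t}

    AllTuples-✱ : ∀ {L} β → AllTuples (λ γ → Q (γ ++ β)) L → AllTuples Q (L ✱ β)
    AllTuples-✱ β = AllP.map⁺ {f = λ t → proj₁ t , proj₂ t ++ β}

    AllTuples-altFaces : ∀ γ F → (∀ k → AllTuples Q (F (removeAt γ k))) → AllTuples Q (altFaces γ F)
    AllTuples-altFaces γ F h = AllP.concat⁺ (AllP.map⁺ {f = λ k → scale (sgn (toℕ k)) (F (removeAt γ k))}
      (AllP.tabulate⁺ (λ k → AllTuples-scale (sgn (toℕ k)) (h k))))

  AllTuples-d : ∀ {P : K → Set} {L} → AllTuples (All P) L → AllTuples (All P) (d L)
  AllTuples-d {L = []}          []       = []
  AllTuples-d {L = (a , γ) ∷ L} (p ∷ ps) = AllP.++⁺ faces (AllTuples-d ps)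
    where
    faces = AllTuples-scale a (AllTuples-altFaces γ (λ β → (1ℤ , β) ∷ []) (λ k → All-removeAt p k ∷ []))

  length≡suc⇒≢[] : ∀ {ρ : List K} {m} → length ρ ≡ suc m → ρ ≢ []
  length≡suc⇒≢[] eq refl = ℕP.0≢1+n eq

  Increasing-removeAt : ∀ {ρ} → Increasing ρ → ∀ k → Increasing (removeAt ρ k)
  Increasing-removeAt = Linked-removeAt (IsStrictTotalOrder.trans <-sto)

  mutual
    length-𝒜 : ∀ m ρ → length ρ ≡ m → AllTuples (λ γ → length γ ≡ suc m) (𝒜 m ρ)
    length-𝒜 0                   ρ eq = []
    length-𝒜 1                   ρ eq = []
    length-𝒜 2                   ρ eq = trans (length-∷ʳ ρ (αs ρ)) (cong suc eq) ∷ []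
    length-𝒜 (suc (suc (suc m))) ρ eq = AllTuples-scale (sgn (suc (suc (suc m)))) (AllTuples-✱ [ αs ρ ]
      (All.map (λ {t} p → trans (length-∷ʳ (proj₂ t) (αs ρ)) (cong suc p)) (length-𝒞 (suc (suc m)) ρ eq)))

    length-𝒞 : ∀ m ρ → length ρ ≡ suc m → AllTuples (λ γ → length γ ≡ suc m) (𝒞 m ρ)
    length-𝒞 m ρ eq = eq ∷ AllTuples-scale (- 1ℤ)
      (AllTuples-altFaces ρ (𝒜 m) (λ k → length-𝒜 m (removeAt ρ k) (length-removeAt-suc ρ k eq)))

  module _ (P : K → Set) where

    αClosed : List K → Set
    αClosed ρ = All P ρ × (∀ σ → Increasing σ → σ ≢ [] → σ ⊆ₛ ρ → P (αs σ))

    αClosed-removeAt : ∀ {ρ} → αClosed ρ → ∀ k → αClosed (removeAt ρ k)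
    αClosed-removeAt {ρ} (entries , alphas) k =
      All-removeAt entries k , λ σ inc ne sub → alphas σ inc ne (λ x → ∈-removeAt⁻ ρ k ∘ sub x)

    All-∷ʳ-αs : ∀ {ρ γ} → Increasing ρ → ρ ≢ [] → αClosed ρ → All P γ → All P (γ ∷ʳ αs ρ)
    All-∷ʳ-αs {ρ} inc ne (_ , alphas) p = AllP.++⁺ p (alphas ρ inc ne (λ _ x∈ → x∈) ∷ [])

    mutual
      entries-𝒜 : ∀ m ρ → Increasing ρ → length ρ ≡ m → αClosed ρ → AllTuples (All P) (𝒜 m ρ)
      entries-𝒜 0                   ρ inc eq cl = []
      entries-𝒜 1                   ρ inc eq cl = []
      entries-𝒜 2                   ρ inc eq cl = All-∷ʳ-αs inc (length≡suc⇒≢[] eq) cl (proj₁ cl) ∷ []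
      entries-𝒜 (suc (suc (suc m))) ρ inc eq cl = AllTuples-scale (sgn (suc (suc (suc m)))) (AllTuples-✱ [ αs ρ ]
        (All.map (All-∷ʳ-αs inc (length≡suc⇒≢[] eq) cl) (entries-𝒞 (suc (suc m)) ρ inc eq cl)))

      entries-𝒞 : ∀ m ρ → Increasing ρ → length ρ ≡ suc m → αClosed ρ → AllTuples (All P) (𝒞 m ρ)
      entries-𝒞 m ρ inc eq cl = proj₁ cl ∷ AllTuples-scale (- 1ℤ) (AllTuples-altFaces ρ (𝒜 m) (λ k →
        entries-𝒜 m (removeAt ρ k) (Increasing-removeAt inc k) (length-removeAt-suc ρ k eq) (αClosed-removeAt cl k)))

    entries-𝒮 : ∀ n τ → Increasing τ → length τ ≡ suc n → αClosed τ → AllTuples (All P) (𝒮 n τ)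
    entries-𝒮 n τ inc eq cl = AllP.++⁺ (AllTuples-d {L = (1ℤ , τ ∷ʳ αs τ) ∷ []} (top ∷ []))
      (AllTuples-scale (- 1ℤ) (AllTuples-altFaces τ (λ ρ → d (𝒜 n ρ ✱ [ αs τ ])) faces))
      where
      top = All-∷ʳ-αs inc (length≡suc⇒≢[] eq) cl (proj₁ cl)
      faces : ∀ k → AllTuples (All P) (d (𝒜 n (removeAt τ k) ✱ [ αs τ ]))
      faces k = AllTuples-d (AllTuples-✱ [ αs τ ] (All.map (All-∷ʳ-αs inc (length≡suc⇒≢[] eq) cl)
        (entries-𝒜 n (removeAt τ k) (Increasing-removeAt inc k) (length-removeAt-suc τ k eq) (αClosed-removeAt cl k))))

  -- FaceChain ps ρ: ps ∷ʳ ρ is a long string for ρ, built by deleting one entry at a time.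
  data FaceChain : List (List K) → List K → Set where
    singleton : ∀ x → FaceChain [] [ x ]
    extend    : ∀ {ps} ρ (k : Fin (length ρ)) → FaceChain ps (removeAt ρ k) → FaceChain (ps ∷ʳ removeAt ρ k) ρ

  longString-∷ʳ : ∀ {ps σ ρ} → LongString σ (ps ∷ʳ σ) → σ ⊆ₛ ρ → length ρ ≡ suc (length σ) → Increasing ρ →
                  LongString ρ (ps ∷ʳ σ ∷ʳ ρ)
  longString-∷ʳ {ps} {σ} {ρ} ((_ , members , linked) , len) σ⊆ρ lenρ incρ =
    (ℕP.≤-reflexive len′ , members′ , Linked-∷ʳ ps linked σ⊆ρ) , len′
    where
    len′ : length (ps ∷ʳ σ ∷ʳ ρ) ≡ length ρ
    len′ = trans (length-∷ʳ (ps ∷ʳ σ) ρ) (trans (cong suc len) (sym lenρ))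
    members′ = lookup-∷ʳ (λ k σ′ → Increasing σ′ × length σ′ ≡ suc k × σ′ ⊆ₛ ρ) (ps ∷ʳ σ)
                 (λ k → let (inc , l , sub) = members k in inc , l , λ x → σ⊆ρ x ∘ sub x)
                 (incρ , trans lenρ (cong suc (sym len)) , λ _ x∈ → x∈)

  faceChain-longString : ∀ {ps ρ} → FaceChain ps ρ → Increasing ρ → LongString ρ (ps ∷ʳ ρ)
  faceChain-longString (singleton x)      _   = (ℕP.≤-refl , (λ { zero → [-] , refl , (λ _ x∈ → x∈) }) , [-]) , refl
  faceChain-longString (extend ρ k chain) inc = longString-∷ʳ (faceChain-longString chain (Increasing-removeAt inc k))
                                                  (λ _ → ∈-removeAt⁻ ρ k) (length-removeAt′ ρ k) inc

  longString-members : ∀ {τ σs} → LongString τ σs → All (λ σ → Increasing σ × σ ≢ [] × σ ⊆ₛ τ) σs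
  longString-members {τ} {σs} ((_ , members , _) , _) = All.tabulate λ σ∈ →
    subst (λ σ → Increasing σ × σ ≢ [] × σ ⊆ₛ τ) (sym (lookup-index σ∈)) (member (index σ∈))
    where
    member : ∀ k → Increasing (lookup σs k) × lookup σs k ≢ [] × lookup σs k ⊆ₛ τ
    member k = let (inc , l , sub) = members k in inc , length≡suc⇒≢[] l , sub

  restriction-value : ∀ {β ε i j} → RestrIs β ε → I β i j → e β i j ≡ fromMaybe 0ℤ (ε i j)
  restriction-value {β} {ε} {i} {j} restr Iβ with e β i j ℤ.≟ 0ℤ
  ... | yes e≡0 = trans e≡0 (sym (cong (fromMaybe 0ℤ) (proj₂ (restr i j) (λ supp → proj₂ supp e≡0))))
  ... | no  e≢0 = sym (cong (fromMaybe 0ℤ) (proj₁ (restr i j) (Iβ , e≢0)))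

  GMonotone : List K → Set
  GMonotone τ = ∀ ρ σ → Increasing ρ → Increasing σ → ρ ≢ [] → ρ ⊊ₛ σ → σ ⊆ₛ τ → ∀ i → g (αs ρ) i ℕ.≤ g (αs σ) i

  below-vertex : ∀ {τ x i j} → All B τ → I τ i j → x ∈ τ → j ℕ.≤ g (αs [ x ]) i
  below-vertex {i = i} {j} bs Iτ x∈ =
    subst (λ a → j ℕ.≤ g a i) (sym (αs-single _ (All.lookup bs x∈))) (All.lookup Iτ x∈)

  module _ (i j : ℕ) where

    below-αs : ∀ {τ} → All B τ → GMonotone τ → I τ i j →
               ∀ σ → Increasing σ → σ ≢ [] → σ ⊆ₛ τ → j ℕ.≤ g (αs σ) i
    below-αs bs mono Iτ []          _   ne _   = ⊥-elim (ne refl)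
    below-αs bs mono Iτ (x ∷ [])    _   _  sub = below-vertex bs Iτ (sub x (here refl))
    below-αs bs mono Iτ (x ∷ y ∷ σ) inc _  sub =
      ℕP.≤-trans (below-vertex bs Iτ (sub x (here refl))) (mono [ x ] (x ∷ y ∷ σ) [-] inc (λ ()) ([x]⊆ , λ ()) sub i)
      where
      [x]⊆ : [ x ] ⊆ₛ (x ∷ y ∷ σ)
      [x]⊆ _ (here x≡) = here x≡

    αClosed-below : ∀ {τ} → All B τ → GMonotone τ → I τ i j → αClosed (λ a → j ℕ.≤ g a i) τ
    αClosed-below bs mono Iτ = Iτ , below-αs bs mono Iτ

    -- The first two faces of τ ⌢ α_τ cover τ.
    Dom-𝒮⇒I : ∀ n {m τ} → length τ ≡ suc (suc m) → Dom (𝒮 n τ) i j → I τ i j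
    Dom-𝒮⇒I n {τ = x ∷ y ∷ τ} _ ((py ∷ pτ) ∷ (px ∷ _) ∷ _) = px ∷ py ∷ AllP.++⁻ˡ τ pτ

    Dom-𝒞⇒I : ∀ c n τ → Dom (scale c (𝒞 n τ)) i j → I τ i j
    Dom-𝒞⇒I c n τ D = All.head (AllP.map⁻ D)

    -- ∂ (eTail β) deletes entries of its argument only; β stays as a fixed tail.
    eTail : List K → List K → ℤ
    eTail β δ = e (δ ++ β) i j

    e-cocycle : ∀ γ → ∂ (λ δ → e δ i j) γ ≡ 0ℤ
    e-cocycle γ = trans (∂-cong coboundary γ) (∂∂≡0 (λ δ → φ δ i j) γ)
      where
      coboundary : ∀ δ → e δ i j ≡ ∂ (λ δ′ → φ δ′ i j) δ
      coboundary δ = Σℤ-allFin (λ k → sgn (toℕ k) * φ (face δ k) i j)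

    ∂eTail-∷ʳ : ∀ β γ a → ∂ (eTail β) (γ ∷ʳ a) ≡ ∂ (eTail (a ∷ β)) γ + sgn (length γ) * eTail β γ
    ∂eTail-∷ʳ β γ a = trans (∂-∷ʳ (eTail β) γ a) (cong (_+ sgn (length γ) * eTail β γ)
      (∂-cong (λ ρ → cong (λ δ → e δ i j) (++-assoc ρ [ a ] β)) γ))

    e-cone : ∀ γ a → e γ i j ≡ - sgn (length γ) * ∂ (eTail [ a ]) γ
    e-cone γ a = isolate (sgn (length γ)) (∂ (eTail [ a ]) γ) (e γ i j) (sgn² (length γ))
                   (trans (sym (∂-∷ʳ (λ δ → e δ i j) γ a)) (e-cocycle (γ ∷ʳ a)))

    eval-e-𝒞 : ∀ n τ → length τ ≡ suc n →
               eval (λ γ → e γ i j) (𝒞 n τ) ≡ - sgn (suc n) * eval (∂ (eTail [ αs τ ])) (𝒞 n τ)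
    eval-e-𝒞 n τ len = trans (eval-cong {f = λ γ → e γ i j} {g = λ γ → s * ∂ (eTail [ αs τ ]) γ}
                                         (All.map (λ {t} → cone t) (length-𝒞 n τ len)))
                             (eval-* s (∂ (eTail [ αs τ ])) (𝒞 n τ))
      where
      s = - sgn (suc n)
      cone : ∀ t → length (proj₂ t) ≡ suc n → e (proj₂ t) i j ≡ s * ∂ (eTail [ αs τ ]) (proj₂ t)
      cone (_ , γ) l = trans (e-cone γ (αs τ)) (cong (λ l′ → - sgn l′ * ∂ (eTail [ αs τ ]) γ) l)

    -- Splitting off the last entry α_σ of each tuple of 𝒜(σ) = ±𝒞(σ) * α_σ: the coboundary part
    -- vanishes by hypothesis and the vertex part, with its sign squared, is what remains.
    eval-∂eTail-𝒜 : ∀ m σ β → length σ ≡ suc (suc m) → eval (∂ (eTail (αs σ ∷ β))) (𝒞 (suc m) σ) ≡ 0ℤ →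
                    eval (∂ (eTail β)) (𝒜 (suc (suc m)) σ) ≡ eval (eTail β) (𝒞 (suc m) σ)
    eval-∂eTail-𝒜 m σ β len vanish = begin
      eval (∂ (eTail β)) (𝒜 (suc (suc m)) σ)
        ≡⟨ eval-𝒜 (∂ (eTail β)) m σ ⟩
      s * eval (λ γ → ∂ (eTail β) (γ ∷ʳ αs σ)) C
        ≡⟨ cong (s *_) (eval-cong {f = λ γ → ∂ (eTail β) (γ ∷ʳ αs σ)} {g = λ γ → Δ′ γ + s * eTail β γ}
                                  (All.map (λ {t} → cone t) (length-𝒞 (suc m) σ len))) ⟩
      s * eval (λ γ → Δ′ γ + s * eTail β γ) C
        ≡⟨ cong (s *_) (eval-+ Δ′ (λ γ → s * eTail β γ) C) ⟩
      s * (eval Δ′ C + eval (λ γ → s * eTail β γ) C)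
        ≡⟨ cong₂ (λ u w → s * (u + w)) vanish (eval-* s (eTail β) C) ⟩
      s * (0ℤ + s * eval (eTail β) C)
        ≡⟨ regroup s (eval (eTail β) C) ⟩
      s * s * eval (eTail β) C
        ≡⟨ cong (_* eval (eTail β) C) (sgn² (suc (suc m))) ⟩
      1ℤ * eval (eTail β) C
        ≡⟨ ℤP.*-identityˡ (eval (eTail β) C) ⟩
      eval (eTail β) C
        ∎
      where
      open ≡-Reasoning
      s : ℤ
      s = sgn (suc (suc m))
      C : FExpr
      C = 𝒞 (suc m) σ
      Δ′ : List K → ℤ
      Δ′ = ∂ (eTail (αs σ ∷ β))
      cone : ∀ t → length (proj₂ t) ≡ suc (suc m) →
             ∂ (eTail β) (proj₂ t ∷ʳ αs σ) ≡ Δ′ (proj₂ t) + s * eTail β (proj₂ t)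
      cone (_ , γ) l = trans (∂eTail-∷ʳ β γ (αs σ)) (cong (λ l′ → Δ′ γ + sgn l′ * eTail β γ) l)
      regroup : ∀ s x → s * (0ℤ + s * x) ≡ s * s * x
      regroup = solve-∀

    -- e takes the value v on α⃗[σ⃗] for every long string σ⃗ passing through ρ, ws being the part above ρ.
    ChainConstant : ℤ → List K → List (List K) → Set
    ChainConstant v ρ ws = ∀ ps → FaceChain ps ρ → e (αvec (ps ++ ρ ∷ ws)) i j ≡ v

    ChainConstant-removeAt : ∀ {v ρ ws} → ChainConstant v ρ ws → ∀ k → ChainConstant v (removeAt ρ k) (ρ ∷ ws)
    ChainConstant-removeAt {v} {ρ} {ws} c k ps chain = subst (λ σs → e (αvec σs) i j ≡ v)
      (++-assoc ps [ removeAt ρ k ] (ρ ∷ ws)) (c (ps ∷ʳ removeAt ρ k) (extend ρ k chain))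

    eval-∂eTail-𝒞₁≡0 : ∀ {v} x₀ x₁ ws → B x₀ → B x₁ → ChainConstant v (x₀ ∷ x₁ ∷ []) ws →
                       eval (∂ (eTail (αvec ((x₀ ∷ x₁ ∷ []) ∷ ws)))) (𝒞 1 (x₀ ∷ x₁ ∷ [])) ≡ 0ℤ
    eval-∂eTail-𝒞₁≡0 {v} x₀ x₁ ws b₀ b₁ c = begin
      eval (∂ (eTail β)) (𝒞 1 ρ)
        ≡⟨ eval-𝒞 (∂ (eTail β)) 1 ρ ⟩
      ∂ (eTail β) ρ - ∂ (λ _ → 0ℤ) ρ
        ≡⟨ cong (λ z → ∂ (eTail β) ρ - z) (∂-zero ρ) ⟩
      (1ℤ * e (x₁ ∷ β) i j + (- 1ℤ * e (x₀ ∷ β) i j + 0ℤ)) - 0ℤ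
        ≡⟨ cong₂ (λ u w → (1ℤ * u + (- 1ℤ * w + 0ℤ)) - 0ℤ) (vertex x₁ b₁ (extend ρ zero (singleton x₁)))
                                                         (vertex x₀ b₀ (extend ρ (suc zero) (singleton x₀))) ⟩
      (1ℤ * v + (- 1ℤ * v + 0ℤ)) - 0ℤ
        ≡⟨ cancel v ⟩
      0ℤ
        ∎
      where
      open ≡-Reasoning
      ρ : List K
      ρ = x₀ ∷ x₁ ∷ []
      β : List K
      β = αvec (ρ ∷ ws)
      vertex : ∀ x → B x → FaceChain [ [ x ] ] ρ → e (x ∷ β) i j ≡ v
      vertex x b chain = trans (cong (λ a → e (a ∷ β) i j) (sym (αs-single x b))) (c [ [ x ] ] chain)
      cancel : ∀ v → (1ℤ * v + (- 1ℤ * v + 0ℤ)) - 0ℤ ≡ 0ℤ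
      cancel = solve-∀

    eval-∂eTail-𝒞≡0 : ∀ {v} m ρ ws → length ρ ≡ suc (suc m) → All B ρ → ChainConstant v ρ ws →
                      eval (∂ (eTail (αvec (ρ ∷ ws)))) (𝒞 (suc m) ρ) ≡ 0ℤ
    eval-∂eTail-𝒞≡0 zero    (x₀ ∷ x₁ ∷ []) ws _   (b₀ ∷ b₁ ∷ []) c = eval-∂eTail-𝒞₁≡0 x₀ x₁ ws b₀ b₁ c
    eval-∂eTail-𝒞≡0 (suc m) ρ              ws len bs              c = begin
      eval Δ (𝒞 (suc (suc m)) ρ)               ≡⟨ eval-𝒞 Δ (suc (suc m)) ρ ⟩
      Δ ρ - ∂ (λ σ → eval Δ (𝒜 (suc (suc m)) σ)) ρ
        ≡⟨ cong (λ z → Δ ρ - z) (∂-cong-faces {f = λ σ → eval Δ (𝒜 (suc (suc m)) σ)} {g = 𝒞-value} ρ transgress) ⟩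
      Δ ρ - ∂ 𝒞-value ρ                        ≡⟨ cong (λ z → Δ ρ - z) (∂-eval-𝒞 (eTail β) (suc m) ρ) ⟩
      Δ ρ - Δ ρ                                ≡⟨ ℤP.+-inverseʳ (Δ ρ) ⟩
      0ℤ                                       ∎
      where
      open ≡-Reasoning
      β : List K
      β = αvec (ρ ∷ ws)
      Δ : List K → ℤ
      Δ = ∂ (eTail β)
      𝒞-value : List K → ℤ
      𝒞-value σ = eval (eTail β) (𝒞 (suc m) σ)
      transgress : ∀ k → eval Δ (𝒜 (suc (suc m)) (removeAt ρ k)) ≡ 𝒞-value (removeAt ρ k)
      transgress k = eval-∂eTail-𝒜 m (removeAt ρ k) β len′
        (eval-∂eTail-𝒞≡0 m (removeAt ρ k) (ρ ∷ ws) len′ (All-removeAt bs k) (ChainConstant-removeAt c k))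
        where
        len′ = length-removeAt-suc ρ k len

    eval-e-𝒞≡0 : ∀ {v} m τ → length τ ≡ suc (suc (suc m)) → All B τ → ChainConstant v τ [] →
                 eval (λ γ → e γ i j) (𝒞 (suc (suc m)) τ) ≡ 0ℤ
    eval-e-𝒞≡0 m τ len bs c = begin
      eval (λ γ → e γ i j) (𝒞 n τ)                   ≡⟨ eval-e-𝒞 n τ len ⟩
      - sgn (suc n) * eval (∂ (eTail [ αs τ ])) (𝒞 n τ) ≡⟨ cong (- sgn (suc n) *_) (eval-∂eTail-𝒞≡0 (suc m) τ [] len bs c) ⟩
      - sgn (suc n) * 0ℤ                              ≡⟨ ℤP.*-zeroʳ (- sgn (suc n)) ⟩
      0ℤ                                              ∎
      where
      open ≡-Reasoning
      n : ℕ
      n = suc (suc m)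

    longStrings⇒ChainConstant : ∀ {τ ε} → Increasing τ → All B τ → GMonotone τ → I τ i j →
                                (∀ σs → LongString τ σs → RestrIs (αvec σs) ε) →
                                ChainConstant (fromMaybe 0ℤ (ε i j)) τ []
    longStrings⇒ChainConstant inc bs mono Iτ restr ps chain = restriction-value (restr (ps ∷ʳ _) long)
      (AllP.map⁺ (All.map (λ {σ} (inc′ , ne , sub) → below-αs bs mono Iτ σ inc′ ne sub) (longString-members long)))
      where
      long = faceChain-longString chain inc

lemma6p4 : (S : Setting) → let open Setting S in
    ∀ (n : ℕ) → 2 ≤ n → (τ : List K) → Increasing τ → All B τ → length τ ≡ suc n →
    U τ → SameFn (𝒮 n τ) (scale (sgn (suc n)) (𝒞 n τ))
lemma6p4 S n@(suc (suc m)) (ℕ.s≤s (ℕ.s≤s ℕ.z≤n)) τ inc bs len ((ε , restr) , mono) i j = to , from , values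
  where
  open Setting S
  s = sgn (suc n)
  Iτ : Dom (𝒮 n τ) i j → I τ i j
  Iτ = Dom-𝒮⇒I S i j n len
  to : Dom (𝒮 n τ) i j → Dom (scale s (𝒞 n τ)) i j
  to D = AllTuples-scale S s (entries-𝒞 S _ n τ inc len (αClosed-below S i j bs mono (Iτ D)))
  from : Dom (scale s (𝒞 n τ)) i j → Dom (𝒮 n τ) i j
  from D = entries-𝒮 S _ n τ inc len (αClosed-below S i j bs mono (Dom-𝒞⇒I S i j s n τ D))
  values : Dom (𝒮 n τ) i j → val (𝒮 n τ) i j ≡ val (scale s (𝒞 n τ)) i j
  values D = begin
    val (𝒮 n τ) i j                     ≡⟨ eval-𝒮≡0 S (e-cocycle S i j) n τ ⟩
    0ℤ                                  ≡⟨ ℤP.*-zeroʳ s ⟨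
    s * 0ℤ                              ≡⟨ cong (s *_) (eval-e-𝒞≡0 S i j m τ len bs chains) ⟨
    s * eval S (λ γ → e γ i j) (𝒞 n τ)  ≡⟨ eval-scale S (λ γ → e γ i j) s (𝒞 n τ) ⟨
    val (scale s (𝒞 n τ)) i j           ∎
    where
    open ≡-Reasoning
    chains = longStrings⇒ChainConstant S i j inc bs mono (Iτ D) restr
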